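{- If $S\subseteq\omega$ is infinite and not immune, then there is a computable permutation $\pi:\omega\to\omega$ such that $\pi(S)$ has density $1$.
   Context: A set is immune if it is infinite and has no infinite c.e. subset. For $X\subseteq\omega$, $\rho_n(X)=|X\cap[0,n)|/n$; $X$ has density $d$ if $\lim_n\rho_n(X)=d$. -}

module Defs where

open import Data.Nat using (ℕ; zero; suc; _*_; _≤_; _<_)
open import Data.Fin using (Fin)
open import Data.Vec using (Vec; []; _∷_; lookup)
open import Data.Product using (Σ; ∃; _×_)
open import Relation.Binary.PropositionalEquality using (_≡_)
open import Function.Definitions using (Injective; Bijective)

Subset : Set₁
Subset = ℕ → Set

_⊆_ : Subset → Subset → Set
A ⊆ B = ∀ x → A x → B x

Infinite : Subset → Set
Infinite A = ∀ n → ∃ λ m → n ≤ m × A m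

-- A model of computation: codes of (partial) μ-recursive functions.

data Code : ℕ → Set where
  zer  : ∀ {n} → Code n
  succ : Code 1
  proj : ∀ {n} → Fin n → Code n
  comp : ∀ {n m} → Code m → Vec (Code n) m → Code n
  prec : ∀ {n} → Code n → Code (suc (suc n)) → Code (suc n)
  mu   : ∀ {n} → Code (suc n) → Code n

-- Big-step semantics: Eval e xs y  means  e halts on input xs with output y.
mutual
  data Eval : ∀ {n} → Code n → Vec ℕ n → ℕ → Set where
    ev-zer  : ∀ {n} {xs : Vec ℕ n} → Eval zer xs 0
    ev-succ : ∀ {x} → Eval succ (x ∷ []) (suc x)
    ev-proj : ∀ {n} {i : Fin n} {xs} → Eval (proj i) xs (lookup xs i)
    ev-comp : ∀ {n m} {f : Code m} {gs : Vec (Code n) m} {xs ys y} →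
              EvalAll gs xs ys → Eval f ys y → Eval (comp f gs) xs y
    ev-prec0 : ∀ {n} {f : Code n} {g} {xs y} →
               Eval f xs y → Eval (prec f g) (0 ∷ xs) y
    ev-precS : ∀ {n} {f : Code n} {g} {xs k r y} →
               Eval (prec f g) (k ∷ xs) r → Eval g (k ∷ r ∷ xs) y →
               Eval (prec f g) (suc k ∷ xs) y
    ev-mu   : ∀ {n} {f : Code (suc n)} {xs y} →
              Eval f (y ∷ xs) 0 →
              (∀ z → z < y → ∃ λ v → Eval f (z ∷ xs) (suc v)) →
              Eval (mu f) xs y

  data EvalAll : ∀ {n m} → Vec (Code n) m → Vec ℕ n → Vec ℕ m → Set where
    []  : ∀ {n} {xs : Vec ℕ n} → EvalAll [] xs []
    _∷_ : ∀ {n m} {g : Code n} {gs : Vec (Code n) m} {xs y ys} →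
          Eval g xs y → EvalAll gs xs ys → EvalAll (g ∷ gs) xs (y ∷ ys)

Computable : (ℕ → ℕ) → Set
Computable f = Σ (Code 1) λ e → ∀ x → Eval e (x ∷ []) (f x)

CE : Subset → Set
CE W = Σ (Code 1) λ e → (∀ x → W x → ∃ λ y → Eval e (x ∷ []) y)
                      × (∀ x → (∃ λ y → Eval e (x ∷ []) y) → W x)

Immune : Subset → Set₁
Immune A = Infinite A × (∀ W → CE W → W ⊆ A → Infinite W → Data.Empty.⊥)
  where import Data.Empty

-- A has an infinite c.e. subset (positive form of "not immune" for infinite A).
HasInfiniteCESubset : Subset → Set₁
HasInfiniteCESubset A = Σ Subset λ W → CE W × W ⊆ A × Infinite W

ComputablePermutation : (ℕ → ℕ) → Set
ComputablePermutation π = Computable π × Bijective _≡_ _≡_ π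

Image : (ℕ → ℕ) → Subset → Subset
Image f A y = ∃ λ x → A x × f x ≡ y

-- |A ∩ [0,n)| ≥ m : there are m distinct elements of A below n.
AtLeastBelow : Subset → ℕ → ℕ → Set
AtLeastBelow A n m = Σ (Fin m → ℕ) λ g → Injective _≡_ _≡_ g × (∀ i → g i < n × A (g i))

-- A has density 1: lim_n |A ∩ [0,n)|/n = 1.  Since ρ_n(A) ≤ 1 always, this is:
-- for every k, eventually ρ_n(A) ≥ 1 - 1/(k+1), i.e. (k+1)·|A∩[0,n)| ≥ k·n.
HasDensityOne : Subset → Set
HasDensityOne A = ∀ k → ∃ λ N → ∀ n → N ≤ n →
                  ∃ λ m → AtLeastBelow A n m × k * n ≤ suc k * m

-- Let W ⊆ S be infinite and c.e.  Dovetailing the enumeration of W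
-- gives a computable f whose values lie in W and grow with gaps of at least
-- 2 (a sparse enumeration).  The permutation sends the i-th value of f to the
-- i-th non-square and the k-th number outside the range of f to k²; it is
-- computable because every search involved has a computable bound.  Its image
-- of S contains all non-squares, and the non-squares have density one since
-- there are only about √n squares below n.

module Submission where

open import Defs
open import Data.Product using (Σ; _×_)
open import Data.Nat using (ℕ)

open import Data.Product using (_,_; proj₁; proj₂; ∃)
open import Data.Sum using (inj₁; inj₂)
open import Data.Nat using (zero; suc; _+_; _*_; _∸_; _≤_; _<_; z≤n; s≤s; _⊔_; pred; ≢-nonZero)
open import Data.Nat.Properties
open import Data.Fin using (Fin; zero; suc; toℕ; _↑ʳ_)
open import Data.Fin.Properties using (toℕ-injective; toℕ<n)
open import Data.Vec using (Vec; []; _∷_; lookup; map; tabulate; _++_; head; tail)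
open import Data.Vec.Properties using (tabulate∘lookup; tabulate-cong; lookup-++ʳ)
open import Relation.Binary.PropositionalEquality
open import Relation.Nullary using (¬_; yes; no; contradiction)
open import Function.Definitions using (Injective; Bijective)
open import Relation.Binary.Definitions using (tri<; tri≈; tri>)
open import Function using (_∘_)

eval-≡ : ∀ {n} {c : Code n} {xs a b} → Eval c xs a → a ≡ b → Eval c xs b
eval-≡ e refl = e

evalAll-≡ : ∀ {n m} {gs : Vec (Code n) m} {xs ys ys'} → EvalAll gs xs ys → ys ≡ ys' → EvalAll gs xs ys'
evalAll-≡ e refl = e

app₁ : ∀ {n} → Code 1 → Code n → Code n
app₁ f a = comp f (a ∷ [])

app₂ : ∀ {n} → Code 2 → Code n → Code n → Code n
app₂ f a b = comp f (a ∷ b ∷ [])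

ev-app₁ : ∀ {n} {f : Code 1} {a : Code n} {xs x y} →
          Eval a xs x → Eval f (x ∷ []) y → Eval (app₁ f a) xs y
ev-app₁ p q = ev-comp (p ∷ []) q

ev-app₂ : ∀ {n} {f : Code 2} {a b : Code n} {xs x y z} →
          Eval a xs x → Eval b xs y → Eval f (x ∷ y ∷ []) z → Eval (app₂ f a b) xs z
ev-app₂ p q r = ev-comp (p ∷ q ∷ []) r

arg0 : ∀ {n} → Code (suc n)
arg0 = proj zero

arg1 : ∀ {n} → Code (suc (suc n))
arg1 = proj (suc zero)

arg2 : ∀ {n} → Code (suc (suc (suc n)))
arg2 = proj (suc (suc zero))

arg3 : ∀ {n} → Code (suc (suc (suc (suc n))))
arg3 = proj (suc (suc (suc zero)))

one : ∀ {n} → Code n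
one = app₁ succ zer

ev-one : ∀ {n} {xs : Vec ℕ n} → Eval one xs 1
ev-one = ev-app₁ ev-zer ev-succ

dropArgs : ∀ k {n} → Vec (Code (k + n)) n
dropArgs k = tabulate (λ j → proj (k ↑ʳ j))

dropArgs-ok : ∀ {k n} (ys : Vec ℕ k) (xs : Vec ℕ n) → EvalAll (dropArgs k) (ys ++ xs) xs
dropArgs-ok {k} ys xs =
  evalAll-≡ (projections (λ j → k ↑ʳ j))
            (trans (tabulate-cong (lookup-++ʳ ys xs)) (tabulate∘lookup xs))
  where
  projections : ∀ {m} (ρ : Fin m → Fin (k + _)) →
                EvalAll (tabulate (λ j → proj (ρ j))) (ys ++ xs) (tabulate (λ j → lookup (ys ++ xs) (ρ j)))
  projections {zero} ρ = []
  projections {suc m} ρ = ev-proj ∷ projections (λ j → ρ (suc j))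

ifz : ℕ → ℕ → ℕ → ℕ
ifz zero    a b = a
ifz (suc _) a b = b

ifzC : Code 3
ifzC = prec arg0 arg3

ifzC-ok : ∀ d a b → Eval ifzC (d ∷ a ∷ b ∷ []) (ifz d a b)
ifzC-ok zero    a b = ev-prec0 ev-proj
ifzC-ok (suc d) a b = ev-precS (ifzC-ok d a b) ev-proj

IfZero : ∀ {n} → Code n → Code n → Code n → Code n
IfZero d a b = comp ifzC (d ∷ a ∷ b ∷ [])

ev-IfZero : ∀ {n} {d a b : Code n} {xs x y z} →
            Eval d xs x → Eval a xs y → Eval b xs z → Eval (IfZero d a b) xs (ifz x y z)
ev-IfZero p q r = ev-comp (p ∷ q ∷ r ∷ []) (ifzC-ok _ _ _)

predC : Code 1
predC = prec zer arg0

predC-ok : ∀ k → Eval predC (k ∷ []) (pred k)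
predC-ok zero    = ev-prec0 ev-zer
predC-ok (suc k) = ev-precS (predC-ok k) ev-proj

addC : Code 2
addC = prec arg0 (app₁ succ arg1)

addC-ok : ∀ k x → Eval addC (k ∷ x ∷ []) (k + x)
addC-ok zero    x = ev-prec0 ev-proj
addC-ok (suc k) x = ev-precS (addC-ok k x) (ev-app₁ ev-proj ev-succ)

mulC : Code 2
mulC = prec zer (app₂ addC arg1 arg2)

mulC-ok : ∀ k x → Eval mulC (k ∷ x ∷ []) (k * x)
mulC-ok zero    x = ev-prec0 ev-zer
mulC-ok (suc k) x =
  ev-precS (mulC-ok k x) (eval-≡ (ev-app₂ ev-proj ev-proj (addC-ok _ _)) (+-comm (k * x) x))

-- Truncated subtraction, with the subtrahend as first argument.
monusC : Code 2
monusC = prec arg0 (app₁ predC arg1)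

monusC-ok : ∀ y x → Eval monusC (y ∷ x ∷ []) (x ∸ y)
monusC-ok zero    x = ev-prec0 ev-proj
monusC-ok (suc y) x =
  ev-precS (monusC-ok y x) (eval-≡ (ev-app₁ ev-proj (predC-ok _)) (pred[m∸n]≡m∸[1+n] x y))

-- Clocked evaluation.  run e t xs is 0 if e has not halted on xs within
-- clock t, and suc v if it has, with output v.  A minimisation at clock t
-- inspects the candidates 0 … t, each with clock t.

-- Positive iff every entry is positive, i.e. every sub-run has halted.
allHalted : ∀ {m} → Vec ℕ m → ℕ
allHalted []       = 1
allHalted (r ∷ rs) = ifz r 0 (allHalted rs)

-- State of a minimisation after inspecting candidate j with result r:
-- 0 = keep searching, 1 = a candidate did not halt, suc (suc y) = found y;
-- nonzero states are final.
searchStep : ℕ → ℕ → ℕ → ℕ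
searchStep (suc s) r             j = suc s
searchStep zero    zero          j = 1
searchStep zero    (suc zero)    j = suc (suc j)
searchStep zero    (suc (suc _)) j = 0

mutual
  run : ∀ {n} → Code n → ℕ → Vec ℕ n → ℕ
  run zer         t xs       = 1
  run succ        t (x ∷ []) = suc (suc x)
  run (proj i)    t xs       = suc (lookup xs i)
  run (comp f gs) t xs       = ifz (allHalted (runAll gs t xs)) 0 (run f t (map pred (runAll gs t xs)))
  run (prec f g)  t (k ∷ xs) = runRec f g t k xs
  run (mu f)      t xs       = pred (runSearch f t xs (suc t))

  runAll : ∀ {n m} → Vec (Code n) m → ℕ → Vec ℕ n → Vec ℕ m
  runAll []       t xs = []
  runAll (g ∷ gs) t xs = run g t xs ∷ runAll gs t xs

  runRec : ∀ {n} → Code n → Code (suc (suc n)) → ℕ → ℕ → Vec ℕ n → ℕ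
  runRec f g t zero    xs = run f t xs
  runRec f g t (suc k) xs = ifz (runRec f g t k xs) 0 (run g t (k ∷ pred (runRec f g t k xs) ∷ xs))

  runSearch : ∀ {n} → Code (suc n) → ℕ → Vec ℕ n → ℕ → ℕ
  runSearch f t xs zero    = 0
  runSearch f t xs (suc j) = searchStep (runSearch f t xs j) (run f t (j ∷ xs)) j

searchStepC : Code 3
searchStepC = IfZero arg0 (IfZero arg1 one (IfZero (app₁ predC arg1) (app₁ succ (app₁ succ arg2)) zer)) arg0

searchStepC-ok : ∀ s r j → Eval searchStepC (s ∷ r ∷ j ∷ []) (searchStep s r j)
searchStepC-ok s r j =
  eval-≡ (ev-IfZero ev-proj
           (ev-IfZero ev-proj ev-one
             (ev-IfZero (ev-app₁ ev-proj (predC-ok r)) (ev-app₁ (ev-app₁ ev-proj ev-succ) ev-succ) ev-zer))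
           ev-proj)
         (cases s r)
  where
  cases : ∀ s r → ifz s (ifz r 1 (ifz (pred r) (suc (suc j)) 0)) s ≡ searchStep s r j
  cases (suc s) r             = refl
  cases zero    zero          = refl
  cases zero    (suc zero)    = refl
  cases zero    (suc (suc r)) = refl

mutual
  clocked : ∀ {n} → Code n → Code (suc n)
  clocked zer         = one
  clocked succ        = app₁ succ (app₁ succ arg1)
  clocked (proj i)    = app₁ succ (proj (suc i))
  clocked (comp f gs) = IfZero (allHaltedC gs) zer (comp (clocked f) (arg0 ∷ outputsC gs))
  clocked (prec f g)  = comp (prec (clocked f) (recStepC g)) (arg1 ∷ arg0 ∷ dropArgs 2)
  clocked (mu f)      = app₁ predC (comp (prec zer (searchC f)) (app₁ succ arg0 ∷ arg0 ∷ dropArgs 1))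

  allHaltedC : ∀ {n m} → Vec (Code n) m → Code (suc n)
  allHaltedC []       = one
  allHaltedC (g ∷ gs) = IfZero (clocked g) zer (allHaltedC gs)

  outputsC : ∀ {n m} → Vec (Code n) m → Vec (Code (suc n)) m
  outputsC []       = []
  outputsC (g ∷ gs) = app₁ predC (clocked g) ∷ outputsC gs

  -- on (k ∷ r ∷ t ∷ xs), where r is the clocked result at k
  recStepC : ∀ {n} → Code (suc (suc n)) → Code (suc (suc (suc n)))
  recStepC g = IfZero arg1 zer (comp (clocked g) (arg2 ∷ arg0 ∷ app₁ predC arg1 ∷ dropArgs 3))

  -- on (j ∷ s ∷ t ∷ xs), where s is the search state before candidate j
  searchC : ∀ {n} → Code (suc n) → Code (suc (suc (suc n)))
  searchC f = comp searchStepC (arg1 ∷ comp (clocked f) (arg2 ∷ arg0 ∷ dropArgs 3) ∷ arg0 ∷ [])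

mutual
  clocked-ok : ∀ {n} (e : Code n) t xs → Eval (clocked e) (t ∷ xs) (run e t xs)
  clocked-ok zer         t xs       = ev-one
  clocked-ok succ        t (x ∷ []) = ev-app₁ (ev-app₁ ev-proj ev-succ) ev-succ
  clocked-ok (proj i)    t xs       = ev-app₁ ev-proj ev-succ
  clocked-ok (comp f gs) t xs       =
    ev-IfZero (allHaltedC-ok gs t xs) ev-zer (ev-comp (ev-proj ∷ outputsC-ok gs t xs) (clocked-ok f t _))
  clocked-ok (prec f g)  t (k ∷ xs) =
    ev-comp (ev-proj ∷ ev-proj ∷ dropArgs-ok (t ∷ k ∷ []) xs) (clockedRec-ok f g t k xs)
  clocked-ok (mu f)      t xs       =
    ev-app₁ (ev-comp (ev-app₁ ev-proj ev-succ ∷ ev-proj ∷ dropArgs-ok (t ∷ []) xs) (clockedSearch-ok f t xs (suc t)))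
            (predC-ok _)

  allHaltedC-ok : ∀ {n m} (gs : Vec (Code n) m) t xs → Eval (allHaltedC gs) (t ∷ xs) (allHalted (runAll gs t xs))
  allHaltedC-ok []       t xs = ev-one
  allHaltedC-ok (g ∷ gs) t xs = ev-IfZero (clocked-ok g t xs) ev-zer (allHaltedC-ok gs t xs)

  outputsC-ok : ∀ {n m} (gs : Vec (Code n) m) t xs → EvalAll (outputsC gs) (t ∷ xs) (map pred (runAll gs t xs))
  outputsC-ok []       t xs = []
  outputsC-ok (g ∷ gs) t xs = ev-app₁ (clocked-ok g t xs) (predC-ok _) ∷ outputsC-ok gs t xs

  clockedRec-ok : ∀ {n} (f : Code n) g t k xs → Eval (prec (clocked f) (recStepC g)) (k ∷ t ∷ xs) (runRec f g t k xs)
  clockedRec-ok f g t zero    xs = ev-prec0 (clocked-ok f t xs)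
  clockedRec-ok f g t (suc k) xs =
    ev-precS (clockedRec-ok f g t k xs)
      (ev-IfZero ev-proj ev-zer
        (ev-comp (ev-proj ∷ ev-proj ∷ ev-app₁ ev-proj (predC-ok _) ∷ dropArgs-ok (k ∷ _ ∷ t ∷ []) xs)
                 (clocked-ok g t _)))

  clockedSearch-ok : ∀ {n} (f : Code (suc n)) t xs j → Eval (prec zer (searchC f)) (j ∷ t ∷ xs) (runSearch f t xs j)
  clockedSearch-ok f t xs zero    = ev-prec0 ev-zer
  clockedSearch-ok f t xs (suc j) =
    ev-precS (clockedSearch-ok f t xs j)
      (ev-comp (ev-proj ∷ ev-comp (ev-proj ∷ ev-proj ∷ dropArgs-ok (j ∷ _ ∷ t ∷ []) xs) (clocked-ok f t (j ∷ xs)) ∷ ev-proj ∷ [])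
               (searchStepC-ok _ _ _))

Rejected : ∀ {n} → Code (suc n) → ℕ → Vec ℕ n → ℕ → Set
Rejected f t xs z = ∃ λ w → run f t (z ∷ xs) ≡ suc (suc w)

RejectedBelow : ∀ {n} → Code (suc n) → ℕ → Vec ℕ n → ℕ → Set
RejectedBelow f t xs y = ∀ z → z < y → Rejected f t xs z

search-running : ∀ {n} (f : Code (suc n)) t xs j → runSearch f t xs j ≡ 0 → RejectedBelow f t xs j
search-running f t xs (suc j) eq z z<1+j with runSearch f t xs j in running
search-running f t xs (suc j) () z z<1+j | suc s
... | zero with run f t (j ∷ xs) in result
search-running f t xs (suc j) () z z<1+j | zero | zero
search-running f t xs (suc j) () z z<1+j | zero | suc zero
search-running f t xs (suc j) eq z z<1+j | zero | suc (suc w) with m≤n⇒m<n∨m≡n (≤-pred z<1+j)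
... | inj₁ z<j  = search-running f t xs j running z z<j
... | inj₂ refl = w , result

search-found : ∀ {n} (f : Code (suc n)) t xs j y → runSearch f t xs j ≡ suc (suc y) →
               y < j × run f t (y ∷ xs) ≡ 1 × RejectedBelow f t xs y
search-found f t xs (suc j) y eq with runSearch f t xs j in earlier
... | suc s with refl ← eq = let (y<j , hit , below) = search-found f t xs j y earlier in m<n⇒m<1+n y<j , hit , below
... | zero with run f t (j ∷ xs) in result
search-found f t xs (suc j) y ()   | zero | zero
search-found f t xs (suc j) y refl | zero | suc zero    = ≤-refl , result , search-running f t xs j earlier
search-found f t xs (suc j) y ()   | zero | suc (suc w)

search-rejecting : ∀ {n} (f : Code (suc n)) t xs j → RejectedBelow f t xs j → runSearch f t xs j ≡ 0
search-rejecting f t xs zero    below = refl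
search-rejecting f t xs (suc j) below
  rewrite search-rejecting f t xs j (λ z z<j → below z (m<n⇒m<1+n z<j)) with below j ≤-refl
... | w , rejected rewrite rejected = refl

search-finds : ∀ {n} (f : Code (suc n)) t xs j y → y < j → run f t (y ∷ xs) ≡ 1 →
               RejectedBelow f t xs y → runSearch f t xs j ≡ suc (suc y)
search-finds f t xs (suc j) y y<1+j hit below with m≤n⇒m<n∨m≡n (≤-pred y<1+j)
... | inj₁ y<j  rewrite search-finds f t xs j y y<j hit below = refl
... | inj₂ refl rewrite search-rejecting f t xs y below | hit = refl

mutual
  run-sound : ∀ {n} (e : Code n) t xs v → run e t xs ≡ suc v → Eval e xs v
  run-sound zer         t xs       .0       refl = ev-zer
  run-sound succ        t (x ∷ []) .(suc x) refl = ev-succ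
  run-sound (proj i)    t xs       _        refl = ev-proj
  run-sound (comp f gs) t xs       v eq with allHalted (runAll gs t xs) in halted
  ... | suc _ = ev-comp (runAll-sound gs t xs halted) (run-sound f t _ v eq)
  run-sound (prec f g)  t (k ∷ xs) v eq = runRec-sound f g t k xs v eq
  run-sound (mu f)      t xs       v eq with runSearch f t xs (suc t) in searched
  ... | suc (suc y) with refl ← eq =
    let (_ , hit , below) = search-found f t xs (suc t) y searched in
    ev-mu (run-sound f t (y ∷ xs) 0 hit)
          (λ z z<y → let (w , rejected) = below z z<y in w , run-sound f t (z ∷ xs) (suc w) rejected)

  runAll-sound : ∀ {n m} (gs : Vec (Code n) m) t xs {a} → allHalted (runAll gs t xs) ≡ suc a →
                 EvalAll gs xs (map pred (runAll gs t xs))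
  runAll-sound []       t xs eq = []
  runAll-sound (g ∷ gs) t xs eq with run g t xs in halted
  ... | suc w = run-sound g t xs w halted ∷ runAll-sound gs t xs eq

  runRec-sound : ∀ {n} (f : Code n) g t k xs v → runRec f g t k xs ≡ suc v → Eval (prec f g) (k ∷ xs) v
  runRec-sound f g t zero    xs v eq = ev-prec0 (run-sound f t xs v eq)
  runRec-sound f g t (suc k) xs v eq with runRec f g t k xs in earlier
  ... | suc r = ev-precS (runRec-sound f g t k xs r earlier) (run-sound g t (k ∷ r ∷ xs) v eq)

mutual
  run-mono : ∀ {n} (e : Code n) {t t'} xs {v} → t ≤ t' → run e t xs ≡ suc v → run e t' xs ≡ suc v
  run-mono zer         xs       t≤t' eq = eq
  run-mono succ        (x ∷ []) t≤t' eq = eq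
  run-mono (proj i)    xs       t≤t' eq = eq
  run-mono (comp f gs) {t} xs t≤t' eq with allHalted (runAll gs t xs) in halted
  ... | suc _ rewrite runAll-mono gs xs t≤t' halted | halted = run-mono f _ t≤t' eq
  run-mono (prec f g)  (k ∷ xs) t≤t' eq = runRec-mono f g k xs t≤t' eq
  run-mono (mu f)      {t} {t'} xs t≤t' eq with runSearch f t xs (suc t) in searched
  ... | suc (suc y) with refl ← eq =
    let (y<1+t , hit , below) = search-found f t xs (suc t) y searched in
    cong pred (search-finds f t' xs (suc t') y (≤-trans y<1+t (s≤s t≤t')) (run-mono f (y ∷ xs) t≤t' hit)
                (λ z z<y → let (w , rejected) = below z z<y in w , run-mono f (z ∷ xs) t≤t' rejected))

  runAll-mono : ∀ {n m} (gs : Vec (Code n) m) {t t'} xs {a} → t ≤ t' → allHalted (runAll gs t xs) ≡ suc a →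
                runAll gs t' xs ≡ runAll gs t xs
  runAll-mono []       xs t≤t' eq = refl
  runAll-mono (g ∷ gs) {t} xs t≤t' eq with run g t xs in halted
  ... | suc w = cong₂ _∷_ (run-mono g xs t≤t' halted) (runAll-mono gs xs t≤t' eq)

  runRec-mono : ∀ {n} (f : Code n) g k xs {t t' v} → t ≤ t' → runRec f g t k xs ≡ suc v → runRec f g t' k xs ≡ suc v
  runRec-mono f g zero    xs t≤t' eq = run-mono f xs t≤t' eq
  runRec-mono f g (suc k) xs {t} t≤t' eq with runRec f g t k xs in earlier
  ... | suc r rewrite runRec-mono f g k xs t≤t' earlier = run-mono g (k ∷ r ∷ xs) t≤t' eq

mono-⊔ˡ : ∀ {n} (e : Code n) {t} t' xs {v} → run e t xs ≡ suc v → run e (t ⊔ t') xs ≡ suc v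
mono-⊔ˡ e {t} t' xs = run-mono e xs (m≤m⊔n t t')

mono-⊔ʳ : ∀ {n} (e : Code n) t {t'} xs {v} → run e t' xs ≡ suc v → run e (t ⊔ t') xs ≡ suc v
mono-⊔ʳ e t {t'} xs = run-mono e xs (m≤n⊔m t t')

runAll-mono-halted : ∀ {n m} (gs : Vec (Code n) m) {t t'} xs ys → t ≤ t' →
                     runAll gs t xs ≡ map suc ys → runAll gs t' xs ≡ map suc ys
runAll-mono-halted []       xs []       t≤t' eq = refl
runAll-mono-halted (g ∷ gs) xs (y ∷ ys) t≤t' eq =
  cong₂ _∷_ (run-mono g xs t≤t' (cong head eq)) (runAll-mono-halted gs xs ys t≤t' (cong tail eq))

allHalted-suc : ∀ {m} (ys : Vec ℕ m) → allHalted (map suc ys) ≡ 1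
allHalted-suc []       = refl
allHalted-suc (y ∷ ys) = allHalted-suc ys

map-pred-suc : ∀ {m} (ys : Vec ℕ m) → map pred (map suc ys) ≡ ys
map-pred-suc []       = refl
map-pred-suc (y ∷ ys) = cong (y ∷_) (map-pred-suc ys)

run-comp : ∀ {n m} (f : Code m) (gs : Vec (Code n) m) t xs ys {v} →
           runAll gs t xs ≡ map suc ys → run f t ys ≡ suc v → run (comp f gs) t xs ≡ suc v
run-comp f gs t xs ys args result rewrite args | allHalted-suc ys | map-pred-suc ys = result

runRec-step : ∀ {n} (f : Code n) g {t k xs r v} →
              runRec f g t k xs ≡ suc r → run g t (k ∷ r ∷ xs) ≡ suc v → runRec f g t (suc k) xs ≡ suc v
runRec-step f g earlier step rewrite earlier = step

mutual
  run-complete : ∀ {n} {e : Code n} {xs v} → Eval e xs v → ∃ λ t → run e t xs ≡ suc v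
  run-complete ev-zer  = 0 , refl
  run-complete ev-succ = 0 , refl
  run-complete ev-proj = 0 , refl
  run-complete {e = comp f gs} {xs} (ev-comp {ys = ys} args result)
    with runAll-complete args | run-complete result
  ... | t₁ , args-halt | t₂ , halts =
    t₁ ⊔ t₂ , run-comp f gs (t₁ ⊔ t₂) xs ys (runAll-mono-halted gs xs ys (m≤m⊔n t₁ t₂) args-halt) (mono-⊔ʳ f t₁ ys halts)
  run-complete (ev-prec0 base) = run-complete base
  run-complete {e = prec f g} {suc k ∷ xs} (ev-precS {r = r} earlier step)
    with run-complete earlier | run-complete step
  ... | t₁ , earlier-halts | t₂ , step-halts =
    t₁ ⊔ t₂ , runRec-step f g (mono-⊔ˡ (prec f g) t₂ (k ∷ xs) earlier-halts) (mono-⊔ʳ g t₁ (k ∷ r ∷ xs) step-halts)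
  run-complete {e = mu f} {xs} {y} (ev-mu hit rejected)
    with run-complete hit | rejected-complete f xs y rejected
  ... | t₁ , hit-halts | t₂ , below =
    let t = (t₁ ⊔ t₂) ⊔ y
        t₁≤t = ≤-trans (m≤m⊔n t₁ t₂) (m≤m⊔n _ y)
        t₂≤t = ≤-trans (m≤n⊔m t₁ t₂) (m≤m⊔n _ y) in
    t , cong pred (search-finds f t xs (suc t) y (s≤s (m≤n⊔m (t₁ ⊔ t₂) y)) (run-mono f (y ∷ xs) t₁≤t hit-halts)
                    (λ z z<y → let (w , r) = below z z<y in w , run-mono f (z ∷ xs) t₂≤t r))

  runAll-complete : ∀ {n m} {gs : Vec (Code n) m} {xs ys} → EvalAll gs xs ys → ∃ λ t → runAll gs t xs ≡ map suc ys
  runAll-complete [] = 0 , refl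
  runAll-complete {gs = g ∷ gs} {xs} {y ∷ ys} (p ∷ ps) with run-complete p | runAll-complete ps
  ... | t₁ , halts | t₂ , rest =
    t₁ ⊔ t₂ , cong₂ _∷_ (mono-⊔ˡ g t₂ xs halts) (runAll-mono-halted gs xs ys (m≤n⊔m t₁ t₂) rest)

  rejected-complete : ∀ {n} (f : Code (suc n)) xs y → (∀ z → z < y → ∃ λ v → Eval f (z ∷ xs) (suc v)) →
                      ∃ λ t → RejectedBelow f t xs y
  rejected-complete f xs zero    rejected = 0 , λ z ()
  rejected-complete f xs (suc y) rejected
    with rejected-complete f xs y (λ z z<y → rejected z (m<n⇒m<1+n z<y)) | rejected y ≤-refl
  ... | t₁ , below | w , last with run-complete last
  ... | t₂ , last-halts = t₁ ⊔ t₂ , extend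
    where
    extend : RejectedBelow f (t₁ ⊔ t₂) xs (suc y)
    extend z z<1+y with m≤n⇒m<n∨m≡n (≤-pred z<1+y)
    ... | inj₁ z<y  = let (w' , r) = below z z<y in w' , mono-⊔ˡ f t₂ (z ∷ xs) r
    ... | inj₂ refl = w , mono-⊔ʳ f t₁ (z ∷ xs) last-halts

-- Bounded search.  leastZero φ b is the least i ≤ b with φ i ≡ 0 (and b if
-- there is none); when φ b ≡ 0 it is what minimisation computes.

leastZero : (ℕ → ℕ) → ℕ → ℕ
leastZero φ zero    = zero
leastZero φ (suc b) = ifz (φ (leastZero φ b)) (leastZero φ b) (suc b)

leastZero-≤ : ∀ (φ : ℕ → ℕ) b → leastZero φ b ≤ b
leastZero-≤ φ zero    = z≤n
leastZero-≤ φ (suc b) with φ (leastZero φ b)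
... | zero  = m≤n⇒m≤1+n (leastZero-≤ φ b)
... | suc _ = ≤-refl

leastZero-hit : ∀ (φ : ℕ → ℕ) b {y} → φ y ≡ 0 → y ≤ b → φ (leastZero φ b) ≡ 0
leastZero-hit φ zero    φy≡0 z≤n = φy≡0
leastZero-hit φ (suc b) {y} φy≡0 y≤1+b with φ (leastZero φ b) in found
... | zero  = found
... | suc _ with m≤n⇒m<n∨m≡n y≤1+b
...   | inj₂ refl = φy≡0
...   | inj₁ y<1+b = contradiction (trans (sym found) (leastZero-hit φ b φy≡0 (≤-pred y<1+b))) λ ()

leastZero-min : ∀ (φ : ℕ → ℕ) b {z} → z < leastZero φ b → φ z ≢ 0
leastZero-min φ (suc b) {z} z<l φz≡0 with φ (leastZero φ b) in found
... | zero  = leastZero-min φ b z<l φz≡0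
... | suc _ = contradiction (trans (sym found) (leastZero-hit φ b φz≡0 (≤-pred z<l))) λ ()

leastZero-least : ∀ (φ : ℕ → ℕ) b {y} → φ y ≡ 0 → leastZero φ b ≤ y
leastZero-least φ b {y} φy≡0 with leastZero φ b ≤? y
... | yes l≤y = l≤y
... | no  l≰y = contradiction φy≡0 (leastZero-min φ b (≰⇒> l≰y))

mu-leastZero : ∀ {n} (F : Code (suc n)) xs φ → (∀ i → Eval F (i ∷ xs) (φ i)) →
               ∀ b → φ b ≡ 0 → Eval (mu F) xs (leastZero φ b)
mu-leastZero F xs φ F-ok b φb≡0 =
  ev-mu (eval-≡ (F-ok _) (leastZero-hit φ b φb≡0 ≤-refl))
        (λ z z<l → pred (φ z) , eval-≡ (F-ok z) (sym (suc-pred (φ z) {{≢-nonZero (leastZero-min φ b z<l)}})))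

leastWith : (ℕ → ℕ) → (ℕ → ℕ) → ℕ → ℕ
leastWith h g = leastZero (λ i → h i ∸ g i)

leastWith-≤ : ∀ (h g : ℕ → ℕ) b → leastWith h g b ≤ b
leastWith-≤ h g = leastZero-≤ (λ i → h i ∸ g i)

leastWith-hit : ∀ (h g : ℕ → ℕ) b {y} → h y ≤ g y → y ≤ b → h (leastWith h g b) ≤ g (leastWith h g b)
leastWith-hit h g b hy≤gy y≤b = m∸n≡0⇒m≤n (leastZero-hit (λ i → h i ∸ g i) b (m≤n⇒m∸n≡0 hy≤gy) y≤b)

leastWith-min : ∀ (h g : ℕ → ℕ) b {z} → z < leastWith h g b → g z < h z
leastWith-min h g b z<l = m∸n≢0⇒n<m (leastZero-min (λ i → h i ∸ g i) b z<l)

leastWith-least : ∀ (h g : ℕ → ℕ) b {y} → h y ≤ g y → leastWith h g b ≤ y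
leastWith-least h g b hy≤gy = leastZero-least (λ i → h i ∸ g i) b (m≤n⇒m∸n≡0 hy≤gy)

leastWith-unique : ∀ (h g : ℕ → ℕ) b {y} → h y ≤ g y → y ≤ b → (∀ z → z < y → g z < h z) → leastWith h g b ≡ y
leastWith-unique h g b {y} hy≤gy y≤b below with m≤n⇒m<n∨m≡n (leastWith-least h g b hy≤gy)
... | inj₂ l≡y = l≡y
... | inj₁ l<y = contradiction (leastWith-hit h g b hy≤gy y≤b) (<⇒≱ (below _ l<y))

mu-leastWith : ∀ {n} (H G : Code (suc n)) xs h g → (∀ i → Eval H (i ∷ xs) (h i)) → (∀ i → Eval G (i ∷ xs) (g i)) →
               ∀ b → h b ≤ g b → Eval (mu (app₂ monusC G H)) xs (leastWith h g b)
mu-leastWith H G xs h g H-ok G-ok b hb≤gb =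
  mu-leastZero _ xs (λ i → h i ∸ g i) (λ i → ev-app₂ (G-ok i) (H-ok i) (monusC-ok _ _)) b (m≤n⇒m∸n≡0 hb≤gb)

-- An infinite c.e. set W has a computable selector: a computable g with
-- r ≤ g r ∈ W for every r.  Given r, dovetail: find the least stage s at
-- which some x ≤ s with r ≤ x is seen to enter W within s steps, then the
-- least such x at that stage.

module Selector (W : Subset) (e : Code 1)
                (W⇒halts : ∀ x → W x → ∃ λ y → Eval e (x ∷ []) y)
                (halts⇒W : ∀ x → (∃ λ y → Eval e (x ∷ []) y) → W x)
                (W-infinite : Infinite W) where

  -- miss s r x ≡ 0 iff r ≤ x and e halts on x within s steps.
  miss : ℕ → ℕ → ℕ → ℕ
  miss s r x = ifz (run e s (x ∷ [])) 1 (r ∸ x)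

  miss-zero : ∀ s r x {v} → r ≤ x → run e s (x ∷ []) ≡ suc v → miss s r x ≡ 0
  miss-zero s r x r≤x halts rewrite halts = m≤n⇒m∸n≡0 r≤x

  miss-zero⁻¹ : ∀ s r x → miss s r x ≡ 0 → r ≤ x × ∃ λ v → run e s (x ∷ []) ≡ suc v
  miss-zero⁻¹ s r x hit with run e s (x ∷ [])
  ... | suc v = m∸n≡0⇒m≤n hit , v , refl

  missUpTo : ℕ → ℕ → ℕ → ℕ
  missUpTo s r zero    = miss s r 0
  missUpTo s r (suc b) = ifz (missUpTo s r b) 0 (miss s r (suc b))

  missUpTo-zero : ∀ s r b {x} → x ≤ b → miss s r x ≡ 0 → missUpTo s r b ≡ 0
  missUpTo-zero s r zero    z≤n hit = hit
  missUpTo-zero s r (suc b) x≤1+b hit with missUpTo s r b in earlier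
  ... | zero  = refl
  ... | suc _ with m≤n⇒m<n∨m≡n x≤1+b
  ...   | inj₂ refl = hit
  ...   | inj₁ x<1+b = contradiction (trans (sym earlier) (missUpTo-zero s r b (≤-pred x<1+b) hit)) λ ()

  missUpTo-zero⁻¹ : ∀ s r b → missUpTo s r b ≡ 0 → ∃ λ x → miss s r x ≡ 0
  missUpTo-zero⁻¹ s r zero    hit = 0 , hit
  missUpTo-zero⁻¹ s r (suc b) hit with missUpTo s r b in earlier
  ... | zero  = missUpTo-zero⁻¹ s r b earlier
  ... | suc _ = suc b , hit

  stage-exists : ∀ r → ∃ λ s → missUpTo s r s ≡ 0
  stage-exists r with W-infinite r
  ... | x , r≤x , Wx with W⇒halts x Wx
  ... | v , halts with run-complete halts
  ... | t , clocked-halts =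
    t ⊔ x , missUpTo-zero (t ⊔ x) r (t ⊔ x) (m≤n⊔m t x) (miss-zero (t ⊔ x) r x r≤x (mono-⊔ˡ e x (x ∷ []) clocked-halts))

  stage : ℕ → ℕ
  stage r = leastZero (λ s → missUpTo s r s) (proj₁ (stage-exists r))

  stage-sees : ∀ r → ∃ λ x → miss (stage r) r x ≡ 0
  stage-sees r = missUpTo-zero⁻¹ (stage r) r (stage r)
                   (leastZero-hit (λ s → missUpTo s r s) (proj₁ (stage-exists r)) (proj₂ (stage-exists r)) ≤-refl)

  select : ℕ → ℕ
  select r = leastZero (miss (stage r) r) (proj₁ (stage-sees r))

  select-hit : ∀ r → miss (stage r) r (select r) ≡ 0
  select-hit r = leastZero-hit (miss (stage r) r) (proj₁ (stage-sees r)) (proj₂ (stage-sees r)) ≤-refl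

  select-≥ : ∀ r → r ≤ select r
  select-≥ r = proj₁ (miss-zero⁻¹ _ r _ (select-hit r))

  select-∈ : ∀ r → W (select r)
  select-∈ r with miss-zero⁻¹ _ r _ (select-hit r)
  ... | _ , v , halts = halts⇒W (select r) (v , run-sound e (stage r) (select r ∷ []) v halts)

  missC : ∀ {n} → Code n → Code n → Code n → Code n
  missC S R X = IfZero (app₂ (clocked e) S X) one (app₂ monusC X R)

  missC-ok : ∀ {n} {S R X : Code n} {xs s r x} →
             Eval S xs s → Eval R xs r → Eval X xs x → Eval (missC S R X) xs (miss s r x)
  missC-ok {s = s} {x = x} S-ok R-ok X-ok =
    ev-IfZero (ev-app₂ S-ok X-ok (clocked-ok e s (x ∷ []))) ev-one (ev-app₂ X-ok R-ok (monusC-ok _ _))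

  -- on (b ∷ s ∷ r ∷ [])
  missUpToC : Code 3
  missUpToC = prec (missC arg0 arg1 zer) (IfZero arg1 zer (missC arg2 arg3 (app₁ succ arg0)))

  missUpToC-ok : ∀ b s r → Eval missUpToC (b ∷ s ∷ r ∷ []) (missUpTo s r b)
  missUpToC-ok zero    s r = ev-prec0 (missC-ok ev-proj ev-proj ev-zer)
  missUpToC-ok (suc b) s r =
    ev-precS (missUpToC-ok b s r) (ev-IfZero ev-proj ev-zer (missC-ok ev-proj ev-proj (ev-app₁ ev-proj ev-succ)))

  stageC : Code 1
  stageC = mu (comp missUpToC (arg0 ∷ arg0 ∷ arg1 ∷ []))

  stageC-ok : ∀ r → Eval stageC (r ∷ []) (stage r)
  stageC-ok r = mu-leastZero _ (r ∷ []) (λ s → missUpTo s r s)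
                  (λ s → ev-comp (ev-proj ∷ ev-proj ∷ ev-proj ∷ []) (missUpToC-ok s s r))
                  (proj₁ (stage-exists r)) (proj₂ (stage-exists r))

  selectC : Code 1
  selectC = mu (missC (app₁ stageC arg1) arg1 arg0)

  select-computable : Computable select
  select-computable =
    selectC , λ r → mu-leastZero _ (r ∷ []) (miss (stage r) r)
                      (λ x → missC-ok (ev-app₁ ev-proj (stageC-ok r)) ev-proj ev-proj)
                      (proj₁ (stage-sees r)) (proj₂ (stage-sees r))

-- A function is sparse if consecutive values are increasing with gap at least 2,
-- so that both its range and the complement of its range are infinite.
Sparse : (ℕ → ℕ) → Set
Sparse f = ∀ i → suc (suc (f i)) ≤ f (suc i)

sparse-enumeration : (W : Subset) → CE W → Infinite W →
                     Σ (ℕ → ℕ) λ f → Computable f × Sparse f × (∀ i → W (f i))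
sparse-enumeration W (e , W⇒halts , halts⇒W) W-infinite =
  f , (F , F-ok) , (λ i → select-≥ _) , f-∈
  where
  open Selector W e W⇒halts halts⇒W W-infinite
  G : Code 1
  G = proj₁ select-computable

  f : ℕ → ℕ
  f zero    = select 0
  f (suc i) = select (suc (suc (f i)))

  f-∈ : ∀ i → W (f i)
  f-∈ zero    = select-∈ 0
  f-∈ (suc i) = select-∈ _

  F : Code 1
  F = prec (app₁ G zer) (app₁ G (app₁ succ (app₁ succ arg1)))

  F-ok : ∀ i → Eval F (i ∷ []) (f i)
  F-ok zero    = ev-prec0 (ev-app₁ ev-zer (proj₂ select-computable 0))
  F-ok (suc i) = ev-precS (F-ok i) (ev-app₁ (ev-app₁ (ev-app₁ ev-proj ev-succ) ev-succ) (proj₂ select-computable _))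

square : ℕ → ℕ
square j = j * j

square-suc : ∀ j → suc (square j) ≤ square (suc j)
square-suc j = s≤s (subst (j * j ≤_) (sym (cong (j +_) (*-suc j j))) (≤-trans (m≤n+m (j * j) j) (m≤n+m _ j)))

square-+ : ∀ a d → square a + d ≤ square (a + d)
square-+ a zero    rewrite +-identityʳ a | +-identityʳ (square a) = ≤-refl
square-+ a (suc d) rewrite +-suc (square a) d | +-suc a d = ≤-trans (s≤s (square-+ a d)) (square-suc (a + d))

square-mono-≤ : ∀ {a b} → a ≤ b → square a ≤ square b
square-mono-≤ a≤b = *-mono-≤ a≤b a≤b

square-mono-< : ∀ {a b} → a < b → square a < square b
square-mono-< {a} a<b = ≤-trans (square-suc a) (square-mono-≤ a<b)

square-injective : ∀ {a b} → square a ≡ square b → a ≡ b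
square-injective {a} {b} eq with <-cmp a b
... | tri< a<b _ _ = contradiction eq (<⇒≢ (square-mono-< a<b))
... | tri≈ _ a≡b _ = a≡b
... | tri> _ _ b<a = contradiction (sym eq) (<⇒≢ (square-mono-< b<a))

square-≥ : ∀ y → y ≤ square y
square-≥ zero    = z≤n
square-≥ (suc y) = m≤m*n (suc y) (suc y)

ceilSqrt : ℕ → ℕ
ceilSqrt y = leastWith (λ _ → y) square y

ceilSqrt-hit : ∀ y → y ≤ square (ceilSqrt y)
ceilSqrt-hit y = leastWith-hit (λ _ → y) square y (square-≥ y) ≤-refl

ceilSqrt-min : ∀ y {z} → z < ceilSqrt y → square z < y
ceilSqrt-min y = leastWith-min (λ _ → y) square y

ceilSqrt-≤ : ∀ y → ceilSqrt y ≤ y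
ceilSqrt-≤ y = leastWith-≤ (λ _ → y) square y

-- ceilSqrt n ≤ n/(k+1) once n ≥ (k+1)(2k+2), since then ceilSqrt n > 2k+2
-- forces (k+1)·ceilSqrt n ≤ (ceilSqrt n ∸ 1)² < n.
ceilSqrt-small : ∀ k n → suc k * (suc k + suc k) ≤ n → suc k * ceilSqrt n ≤ n
ceilSqrt-small k n large with ceilSqrt n in eq
... | zero  = subst (_≤ n) (sym (*-zeroʳ (suc k))) z≤n
... | suc a with suc a ≤? suc k + suc k
...   | yes small = ≤-trans (*-monoʳ-≤ (suc k) small) large
...   | no  big   = ≤-trans bound (<⇒≤ (ceilSqrt-min n (subst (a <_) (sym eq) ≤-refl)))
  where
  2k+2≤a : suc k + suc k ≤ a
  2k+2≤a = ≤-pred (≰⇒> big)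
  k+1≤[k+1]a : suc k ≤ suc k * a
  k+1≤[k+1]a = subst (_≤ suc k * a) (*-identityʳ (suc k)) (*-monoʳ-≤ (suc k) (≤-trans (s≤s z≤n) 2k+2≤a))
  bound : suc k * suc a ≤ square a
  bound = begin
    suc k * suc a         ≡⟨ *-suc (suc k) a ⟩
    suc k + suc k * a     ≤⟨ +-monoˡ-≤ (suc k * a) k+1≤[k+1]a ⟩
    suc k * a + suc k * a ≡⟨ sym (*-distribʳ-+ a (suc k) (suc k)) ⟩
    (suc k + suc k) * a   ≤⟨ *-monoˡ-≤ a 2k+2≤a ⟩
    square a              ∎
    where open ≤-Reasoning

-- squaresBelow c: the least j with c + j < j², which is the number of squares
-- below the c-th non-square  nonSquare c = c + squaresBelow c.
squaresBelow : ℕ → ℕ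
squaresBelow c = leastWith (λ j → suc (c + j)) square (suc (suc c))

-- The search for squaresBelow c succeeds by c + 2: 2(c+2) ≤ (c+2)².
squaresBelow-bound : ∀ c → suc (c + suc (suc c)) ≤ square (suc (suc c))
squaresBelow-bound c = ≤-trans (s≤s (+-monoˡ-≤ (suc (suc c)) (n≤1+n c))) double≤square
  where
  double≤square : suc (suc c) + suc (suc c) ≤ square (suc (suc c))
  double≤square = subst (_≤ square (suc (suc c))) (cong (suc (suc c) +_) (+-identityʳ _))
                    (*-monoˡ-≤ (suc (suc c)) {2} {suc (suc c)} (s≤s (s≤s z≤n)))

squaresBelow-hit : ∀ c → c + squaresBelow c < square (squaresBelow c)
squaresBelow-hit c = leastWith-hit (λ j → suc (c + j)) square (suc (suc c)) (squaresBelow-bound c) ≤-refl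

squaresBelow-min : ∀ c {z} → z < squaresBelow c → square z ≤ c + z
squaresBelow-min c z<j = ≤-pred (leastWith-min (λ j → suc (c + j)) square (suc (suc c)) z<j)

squaresBelow-least : ∀ c {j} → c + j < square j → squaresBelow c ≤ j
squaresBelow-least c = leastWith-least (λ j → suc (c + j)) square (suc (suc c))

nonSquare : ℕ → ℕ
nonSquare c = c + squaresBelow c

-- nonSquare c is not a square: j² lies below it for j < squaresBelow c and
-- above it for j ≥ squaresBelow c.
nonSquare-not-square : ∀ c j → nonSquare c ≢ square j
nonSquare-not-square c j eq with squaresBelow c ≤? j
... | yes below≤j = <-irrefl eq (<-≤-trans (squaresBelow-hit c) (square-mono-≤ below≤j))
... | no  below≰j = <-irrefl (sym eq) (≤-<-trans (squaresBelow-min c (≰⇒> below≰j)) (+-monoʳ-< c (≰⇒> below≰j)))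

nonSquare-mono-< : ∀ {c c'} → c < c' → nonSquare c < nonSquare c'
nonSquare-mono-< {c} {c'} c<c' =
  +-mono-<-≤ c<c' (squaresBelow-least c (≤-<-trans (+-monoˡ-≤ (squaresBelow c') (<⇒≤ c<c')) (squaresBelow-hit c')))

nonSquare-injective : ∀ {c c'} → nonSquare c ≡ nonSquare c' → c ≡ c'
nonSquare-injective {c} {c'} eq with <-cmp c c'
... | tri< c<c' _ _ = contradiction eq (<⇒≢ (nonSquare-mono-< c<c'))
... | tri≈ _ c≡c' _ = c≡c'
... | tri> _ _ c'<c = contradiction (sym eq) (<⇒≢ (nonSquare-mono-< c'<c))

nonSquare-onto : ∀ y → square (ceilSqrt y) ≢ y → nonSquare (y ∸ ceilSqrt y) ≡ y
nonSquare-onto y not-square = trans (cong (c +_) squaresBelow≡j) c+j≡y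
  where
  j = ceilSqrt y
  c = y ∸ j
  c+j≡y : c + j ≡ y
  c+j≡y = m∸n+n≡m (ceilSqrt-≤ y)
  -- every z < j satisfies z² + (j ∸ 1 ∸ z) ≤ (j ∸ 1)² < y, i.e. z² ≤ c + z
  below : ∀ z → z < j → square z ≤ c + z
  below z z<j = ≤-pred (+-cancelʳ-≤ d (suc (square z)) (suc (c + z)) (subst (suc (square z + d) ≤_) rearrange z²+d<y))
    where
    d = j ∸ suc z
    1+z+d≡j : suc z + d ≡ j
    1+z+d≡j = m+[n∸m]≡n z<j
    z²+d<y : square z + d < y
    z²+d<y = ≤-<-trans (square-+ z d) (ceilSqrt-min y (subst (z + d <_) 1+z+d≡j ≤-refl))
    rearrange : y ≡ suc (c + z) + d
    rearrange = begin
      y               ≡⟨ sym c+j≡y ⟩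
      c + j           ≡⟨ cong (c +_) (sym 1+z+d≡j) ⟩
      c + (suc z + d) ≡⟨ sym (+-assoc c (suc z) d) ⟩
      c + suc z + d   ≡⟨ cong (_+ d) (+-suc c z) ⟩
      suc (c + z) + d ∎
      where open ≡-Reasoning
  squaresBelow≡j : squaresBelow c ≡ j
  squaresBelow≡j = ≤-antisym
    (squaresBelow-least c (subst (_< square j) (sym c+j≡y) (≤∧≢⇒< (ceilSqrt-hit y) (not-square ∘ sym))))
    (≮⇒≥ λ below<j → <⇒≱ (squaresBelow-hit c) (below _ below<j))

nonSquare-< : ∀ n i → i < n ∸ ceilSqrt n → nonSquare i < n
nonSquare-< n i i<n∸j =
  ≤-<-trans (+-monoʳ-≤ i (squaresBelow-least i (<-≤-trans i+j<n (ceilSqrt-hit n)))) i+j<n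
  where
  i+j<n : i + ceilSqrt n < n
  i+j<n = subst (i + ceilSqrt n <_) (m∸n+n≡m (ceilSqrt-≤ n)) (+-monoˡ-< (ceilSqrt n) i<n∸j)

Range : (ℕ → ℕ) → Subset
Range h y = ∃ λ i → h i ≡ y

density-mono : ∀ {A B} → A ⊆ B → HasDensityOne A → HasDensityOne B
density-mono A⊆B dense k with dense k
... | N , eventually = N , λ n N≤n →
  let (m , (g , g-injective , g-below) , bound) = eventually n N≤n in
  m , (g , g-injective , λ i → proj₁ (g-below i) , A⊆B _ (proj₂ (g-below i))) , bound

proportion-of-rest : ∀ k n m → suc k * m ≤ n → k * n ≤ suc k * (n ∸ m)
proportion-of-rest k n m small = subst (k * n ≤_) (sym (*-distribˡ-∸ (suc k) n m))
  (≤-trans (≤-reflexive (sym (m+n∸m≡n n (k * n)))) (∸-monoʳ-≤ (suc k * n) small))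

nonSquares-dense : HasDensityOne (Range nonSquare)
nonSquares-dense k = suc k * (suc k + suc k) , λ n large →
  n ∸ ceilSqrt n ,
  ((λ i → nonSquare (toℕ i)) , (λ eq → toℕ-injective (nonSquare-injective eq)) ,
   λ i → nonSquare-< n (toℕ i) (toℕ<n i) , (toℕ i , refl)) ,
  proportion-of-rest k n (ceilSqrt n) (ceilSqrt-small k n large)

module Merge (f : ℕ → ℕ) (sparse : Sparse f) where

  f-mono-< : ∀ {z i} → z < i → f z < f i
  f-mono-< {z} {suc i} z<1+i with m≤n⇒m<n∨m≡n (≤-pred z<1+i)
  ... | inj₁ z<i  = <-trans (f-mono-< z<i) (≤-trans (n≤1+n _) (sparse i))
  ... | inj₂ refl = ≤-trans (n≤1+n _) (sparse i)

  f-mono-≤ : ∀ {z i} → z ≤ i → f z ≤ f i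
  f-mono-≤ z≤i with m≤n⇒m<n∨m≡n z≤i
  ... | inj₁ z<i  = <⇒≤ (f-mono-< z<i)
  ... | inj₂ refl = ≤-refl

  f-double : ∀ i → i + i ≤ f i
  f-double zero    = z≤n
  f-double (suc i) rewrite +-suc i i = ≤-trans (s≤s (s≤s (f-double i))) (sparse i)

  f-≥ : ∀ i → i ≤ f i
  f-≥ i = ≤-trans (m≤m+n i i) (f-double i)

  -- index x: the least i with x ≤ f i, i.e. the number of values of f below x.
  index : ℕ → ℕ
  index x = leastWith (λ _ → x) f x

  index-hit : ∀ x → x ≤ f (index x)
  index-hit x = leastWith-hit (λ _ → x) f x (f-≥ x) ≤-refl

  index-min : ∀ x {i} → i < index x → f i < x
  index-min x = leastWith-min (λ _ → x) f x

  index-≤ : ∀ x → index x ≤ x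
  index-≤ x = leastWith-≤ (λ _ → x) f x

  index-f : ∀ i → index (f i) ≡ i
  index-f i = leastWith-unique (λ _ → f i) f (f i) ≤-refl (f-≥ i) (λ z → f-mono-<)

  -- x is a value of f exactly when f (index x) ≡ x.
  Value : ℕ → Set
  Value x = f (index x) ≡ x

  value-f : ∀ i → Value (f i)
  value-f i = cong f (index-f i)

  index-suc-value : ∀ x → Value x → index (suc x) ≡ suc (index x)
  index-suc-value x value = leastWith-unique (λ _ → suc x) f (suc x)
    (≤-trans (n≤1+n (suc x)) (subst (λ v → suc (suc v) ≤ f (suc (index x))) value (sparse (index x))))
    (s≤s (index-≤ x))
    (λ z z<1+i → s≤s (subst (f z ≤_) value (f-mono-≤ (≤-pred z<1+i))))

  index-suc-gap : ∀ x → ¬ Value x → index (suc x) ≡ index x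
  index-suc-gap x gap = leastWith-unique (λ _ → suc x) f (suc x)
    (≤∧≢⇒< (index-hit x) (gap ∘ sym))
    (≤-trans (index-≤ x) (n≤1+n x))
    (λ z z<i → <-trans (index-min x z<i) (n<1+n x))

  -- gaps x: the number of non-values of f below x.
  gaps : ℕ → ℕ
  gaps x = x ∸ index x

  gaps-suc-value : ∀ x → Value x → gaps (suc x) ≡ gaps x
  gaps-suc-value x value rewrite index-suc-value x value = refl

  gaps-suc-gap : ∀ x → ¬ Value x → gaps (suc x) ≡ suc (gaps x)
  gaps-suc-gap x gap rewrite index-suc-gap x gap = +-∸-assoc 1 (index-≤ x)

  gaps-step : ∀ x → gaps x ≤ gaps (suc x)
  gaps-step x with f (index x) ≟ x
  ... | yes value = ≤-reflexive (sym (gaps-suc-value x value))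
  ... | no  gap   = ≤-trans (n≤1+n _) (≤-reflexive (sym (gaps-suc-gap x gap)))

  gaps-mono : ∀ {x y} → x ≤ y → gaps x ≤ gaps y
  gaps-mono {y = zero}  z≤n = ≤-refl
  gaps-mono {y = suc y} x≤1+y with m≤n⇒m<n∨m≡n x≤1+y
  ... | inj₁ x<1+y = ≤-trans (gaps-mono (≤-pred x<1+y)) (gaps-step y)
  ... | inj₂ refl  = ≤-refl

  gaps-f : ∀ i → i ≤ gaps (f i)
  gaps-f i rewrite index-f i = subst (_≤ f i ∸ i) (m+n∸n≡m i i) (∸-monoˡ-≤ i (f-double i))

  -- gaps counts up by one at each non-value, so every k below gaps B is
  -- gaps x for a non-value x < B.
  gaps-attained : ∀ B k → k < gaps B → ∃ λ x → x < B × ¬ Value x × gaps x ≡ k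
  gaps-attained (suc B) k k<gaps with k <? gaps B
  ... | yes k<gapsB = let (x , x<B , gap , eq) = gaps-attained B k k<gapsB in x , m<n⇒m<1+n x<B , gap , eq
  ... | no  k≮gapsB with f (index B) ≟ B
  ...   | yes value = contradiction (subst (k <_) (gaps-suc-value B value) k<gaps) k≮gapsB
  ...   | no  gap   = B , ≤-refl , gap , ≤-antisym (≮⇒≥ k≮gapsB) (≤-pred (subst (k <_) (gaps-suc-gap B gap) k<gaps))

  -- merge x: nonSquare (index x) if x is a value, square (gaps x) otherwise.
  -- The test f (index x) ∸ x ≡ 0 decides x being a value, as x ≤ f (index x).
  merge : ℕ → ℕ
  merge x = ifz (f (index x) ∸ x) (nonSquare (index x)) (square (gaps x))

  merge-value : ∀ x → Value x → merge x ≡ nonSquare (index x)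
  merge-value x value rewrite value | n∸n≡0 x = refl

  merge-gap : ∀ x → ¬ Value x → merge x ≡ square (gaps x)
  merge-gap x gap with f (index x) ∸ x in eq
  ... | zero  = contradiction (≤-antisym (m∸n≡0⇒m≤n eq) (index-hit x)) gap
  ... | suc _ = refl

  merge-f : ∀ i → merge (f i) ≡ nonSquare i
  merge-f i = trans (merge-value (f i) (value-f i)) (cong nonSquare (index-f i))

  merge-injective : Injective _≡_ _≡_ merge
  merge-injective {x} {y} eq with f (index x) ≟ x | f (index y) ≟ y
  ... | yes vx | yes vy =
    trans (sym vx) (trans (cong f (nonSquare-injective (trans (sym (merge-value x vx)) (trans eq (merge-value y vy))))) vy)
  ... | yes vx | no  gy = contradiction (trans (sym (merge-value x vx)) (trans eq (merge-gap y gy))) (nonSquare-not-square (index x) (gaps y))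
  ... | no  gx | yes vy = contradiction (trans (sym (merge-value y vy)) (trans (sym eq) (merge-gap x gx))) (nonSquare-not-square (index y) (gaps x))
  ... | no  gx | no  gy = gaps-injective (square-injective (trans (sym (merge-gap x gx)) (trans eq (merge-gap y gy))))
    where
    -- gaps strictly increases past a non-value
    gaps-injective : gaps x ≡ gaps y → x ≡ y
    gaps-injective same with <-cmp x y
    ... | tri< x<y _ _ = contradiction same (<⇒≢ (subst (_≤ gaps y) (gaps-suc-gap x gx) (gaps-mono x<y)))
    ... | tri≈ _ x≡y _ = x≡y
    ... | tri> _ _ y<x = contradiction (sym same) (<⇒≢ (subst (_≤ gaps x) (gaps-suc-gap y gy) (gaps-mono y<x)))

  merge-onto : ∀ y → ∃ λ x → merge x ≡ y
  merge-onto y with square (ceilSqrt y) ≟ y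
  ... | yes is-square =
    let (x , _ , gap , gaps≡) = gaps-attained (f (suc (ceilSqrt y))) (ceilSqrt y) (gaps-f (suc (ceilSqrt y))) in
    x , trans (merge-gap x gap) (trans (cong square gaps≡) is-square)
  ... | no not-square = f (y ∸ ceilSqrt y) , trans (merge-f _) (nonSquare-onto y not-square)

  merge-bijective : Bijective _≡_ _≡_ merge
  merge-bijective = merge-injective , λ y → proj₁ (merge-onto y) , λ { refl → proj₂ (merge-onto y) }

  -- merge is computable when f is: every search above is bounded by a known witness.
  merge-computable : Computable f → Computable merge
  merge-computable (F , F-ok) = mergeC , mergeC-ok
    where
    squareC : ∀ {n} → Code n → Code n
    squareC a = app₂ mulC a a

    indexC : Code 1
    indexC = mu (app₂ monusC (app₁ F arg0) arg1)

    indexC-ok : ∀ x → Eval indexC (x ∷ []) (index x)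
    indexC-ok x = mu-leastWith arg1 (app₁ F arg0) (x ∷ []) (λ _ → x) f
                    (λ i → ev-proj) (λ i → ev-app₁ ev-proj (F-ok i)) x (f-≥ x)

    nonSquareC : Code 1
    nonSquareC = app₂ addC arg0 (mu (app₂ monusC (squareC arg0) (app₁ succ (app₂ addC arg1 arg0))))

    nonSquareC-ok : ∀ c → Eval nonSquareC (c ∷ []) (nonSquare c)
    nonSquareC-ok c =
      ev-app₂ ev-proj
        (mu-leastWith _ _ (c ∷ []) (λ j → suc (c + j)) square
          (λ j → ev-app₁ (ev-app₂ ev-proj ev-proj (addC-ok c j)) ev-succ)
          (λ j → ev-app₂ ev-proj ev-proj (mulC-ok j j))
          (suc (suc c)) (squaresBelow-bound c))
        (addC-ok _ _)

    indexArg : Code 1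
    indexArg = app₁ indexC arg0

    mergeC : Code 1
    mergeC = IfZero (app₂ monusC arg0 (app₁ F indexArg)) (app₁ nonSquareC indexArg) (squareC (app₂ monusC indexArg arg0))

    mergeC-ok : ∀ x → Eval mergeC (x ∷ []) (merge x)
    mergeC-ok x =
      ev-IfZero (ev-app₂ ev-proj (ev-app₁ index-ok (F-ok _)) (monusC-ok _ _))
                (ev-app₁ index-ok (nonSquareC-ok _))
                (ev-app₂ gaps-ok gaps-ok (mulC-ok _ _))
      where
      index-ok : Eval indexArg (x ∷ []) (index x)
      index-ok = ev-app₁ ev-proj (indexC-ok x)
      gaps-ok : Eval (app₂ monusC indexArg arg0) (x ∷ []) (gaps x)
      gaps-ok = ev-app₂ index-ok ev-proj (monusC-ok _ _)

mainTheorem11 : (S : Subset) → Infinite S → HasInfiniteCESubset S →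
    Σ (ℕ → ℕ) λ π → ComputablePermutation π × HasDensityOne (Image π S)
mainTheorem11 S _ (W , W-ce , W⊆S , W-infinite) with sparse-enumeration W W-ce W-infinite
... | f , f-computable , sparse , f∈W =
  merge , (merge-computable f-computable , merge-bijective) , density-mono nonSquares⊆image nonSquares-dense
  where
  open Merge f sparse
  nonSquares⊆image : Range nonSquare ⊆ Image merge S
  nonSquares⊆image _ (i , refl) = f i , W⊆S (f i) (f∈W i) , merge-f i
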